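{- Let $q=2^t$ with $t$ a positive odd integer, let $\beta\in\mathbb{F}_{q^2}\setminus\mathbb{F}_q$ be a root of $x^2+x+1$ (so $\beta+1$ is the other root), and let $n$ be a positive integer. Define $$M_n(x)=(x+\beta+1)^n+(x+\beta)^n,\qquad N_n(x)=\beta(x+\beta+1)^n+(\beta+1)(x+\beta)^n .$$ Let $\mu_{q+1}=\{x\in\mathbb{F}_{q^2}: x^{q+1}=1\}$. Then: (1) if $\gcd(n,q^2-1)=1$, then $M_n(x)$ has no root in $\mu_{q+1}$; (2) if $\gcd(n,q^2-1)=1$ and $n\equiv 1\pmod 3$, then $N_n(x)$ has no root in $\mu_{q+1}$.
   Context: $M_n$ and $N_n$ are the denominator and numerator of the Rédei function $R_n(x)=N_n(x)/M_n(x)$ over a field of characteristic 2 with parameter $\alpha=\beta^2+\beta=1$. -}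

module Defs where

open import Level using (Level; _⊔_) renaming (suc to lsuc)
open import Data.Nat using (ℕ; zero; suc)
open import Data.Fin using (Fin)
open import Data.Product using (∃)
open import Relation.Nullary using (¬_)
open import Relation.Binary.PropositionalEquality using (_≡_)
open import Algebra.Bundles using (CommutativeRing)

record FiniteField (c ℓ : Level) (m : ℕ) : Set (lsuc (c ⊔ ℓ)) where
  field
    ring : CommutativeRing c ℓ
  open CommutativeRing ring
  field
    1≉0       : ¬ (1# ≈ 0#)
    inverse   : ∀ x → ¬ (x ≈ 0#) → ∃ λ y → x * y ≈ 1#
    enum      : Fin m → Carrier
    enum-inj  : ∀ i j → enum i ≈ enum j → i ≡ j
    enum-surj : ∀ x → ∃ λ i → enum i ≈ x

module _ {c ℓ : Level} (R : CommutativeRing c ℓ) where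
  open CommutativeRing R

  pow : Carrier → ℕ → Carrier
  pow x zero    = 1#
  pow x (suc n) = x * pow x n

  Mpoly : Carrier → ℕ → Carrier → Carrier
  Mpoly β n x = pow (x + β + 1#) n + pow (x + β) n

  Npoly : Carrier → ℕ → Carrier → Carrier
  Npoly β n x = β * pow (x + β + 1#) n + (β + 1#) * pow (x + β) n

{-# OPTIONS --safe #-}
-- Finiteness forces characteristic 2: translation by 1 permutes the field, so 0 = (q·q)·1 = (1+1)^(2t).
-- Put a = x + β + 1 and b = x + β. For x^(q+1) = 1, Frobenius and β^q = β² (t odd) give the
-- twisted-Frobenius relations a^q x = β a and b^q x = β² b, hence (a^n)^q x^n = β^n a^n and
-- (b^n)^q x^n = β^(2n) b^n. A root of M_n means a^n = b^n, a root of N_n means a^n = β b^n, so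
-- with k = 0 resp. 1 the two relations give β^(k+n) = β^(2(k+n)), i.e. β^(k+n) = 1 and 3 ∣ k+n.
-- This contradicts gcd(n, q²−1) = 1 (as 3 ∣ q²−1), resp. n ≡ 1 (mod 3).
module Submission where

open import Level using (Level)
open import Data.Empty using (⊥-elim)
open import Data.Fin using (Fin)
import Data.Fin as Fin
open import Data.Fin.Permutation using (Permutation′; permutation)
open import Data.Nat using (ℕ; zero; suc; _∸_; _%_; _≤_)
import Data.Nat as ℕ
import Data.Nat.Properties as ℕ
open import Data.Nat.DivMod using (%-distribˡ-+)
open import Data.Nat.Divisibility using (_∣_; divides; _∣0; ∣-refl; ∣m∣n⇒∣m+n; ∣1⇒≡1; n∣m⇒m%n≡0)
open import Data.Nat.GCD using (gcd; gcd-greatest)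
open import Data.Nat.Tactic.RingSolver using (solve-∀)
open import Data.Product using (∃; _,_; proj₁; proj₂)
open import Data.Vec.Functional using (replicate)
open import Relation.Nullary using (¬_)
open import Relation.Nullary.Decidable using (yes; no; map′)
open import Relation.Binary.Definitions using (Decidable)
open import Relation.Binary.PropositionalEquality as ≡ using (_≡_)
open import Algebra.Bundles using (CommutativeRing)
open import Defs

2^[2k+1]≡3c+2 : ∀ k → ∃ λ c → 2 ℕ.^ (2 ℕ.* k ℕ.+ 1) ≡ 3 ℕ.* c ℕ.+ 2
2^[2k+1]≡3c+2 zero    = 0 , ≡.refl
2^[2k+1]≡3c+2 (suc k) with 2^[2k+1]≡3c+2 k
... | c , ih = 4 ℕ.* c ℕ.+ 2 , (begin
  2 ℕ.^ (2 ℕ.* suc k ℕ.+ 1)            ≡⟨ ≡.cong (λ j → 2 ℕ.^ (j ℕ.+ 1)) (ℕ.*-suc 2 k) ⟩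
  2 ℕ.* (2 ℕ.* 2 ℕ.^ (2 ℕ.* k ℕ.+ 1))  ≡⟨ ≡.cong (λ j → 2 ℕ.* (2 ℕ.* j)) ih ⟩
  2 ℕ.* (2 ℕ.* (3 ℕ.* c ℕ.+ 2))        ≡⟨ 2[2[3c+2]]≡3[4c+2]+2 c ⟩
  3 ℕ.* (4 ℕ.* c ℕ.+ 2) ℕ.+ 2          ∎)
  where
  open ≡.≡-Reasoning
  2[2[3c+2]]≡3[4c+2]+2 : ∀ c → 2 ℕ.* (2 ℕ.* (3 ℕ.* c ℕ.+ 2)) ≡ 3 ℕ.* (4 ℕ.* c ℕ.+ 2) ℕ.+ 2
  2[2[3c+2]]≡3[4c+2]+2 = solve-∀

2^t*2^t≡1+3c : ∀ t → ∃ λ c → 2 ℕ.^ t ℕ.* 2 ℕ.^ t ≡ 1 ℕ.+ c ℕ.* 3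
2^t*2^t≡1+3c zero    = 0 , ≡.refl
2^t*2^t≡1+3c (suc t) with 2^t*2^t≡1+3c t
... | c , ih = 4 ℕ.* c ℕ.+ 1 , (begin
  2 ℕ.* 2 ℕ.^ t ℕ.* (2 ℕ.* 2 ℕ.^ t)   ≡⟨ 2a*2a≡4[a*a] (2 ℕ.^ t) ⟩
  4 ℕ.* (2 ℕ.^ t ℕ.* 2 ℕ.^ t)         ≡⟨ ≡.cong (4 ℕ.*_) ih ⟩
  4 ℕ.* (1 ℕ.+ c ℕ.* 3)               ≡⟨ 4[1+3c]≡1+3[4c+1] c ⟩
  1 ℕ.+ (4 ℕ.* c ℕ.+ 1) ℕ.* 3         ∎)
  where
  open ≡.≡-Reasoning
  2a*2a≡4[a*a] : ∀ a → 2 ℕ.* a ℕ.* (2 ℕ.* a) ≡ 4 ℕ.* (a ℕ.* a)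
  2a*2a≡4[a*a] = solve-∀
  4[1+3c]≡1+3[4c+1] : ∀ c → 4 ℕ.* (1 ℕ.+ c ℕ.* 3) ≡ 1 ℕ.+ (4 ℕ.* c ℕ.+ 1) ℕ.* 3
  4[1+3c]≡1+3[4c+1] = solve-∀

3∣2^t*2^t∸1 : ∀ t → 3 ∣ 2 ℕ.^ t ℕ.* 2 ℕ.^ t ℕ.∸ 1
3∣2^t*2^t∸1 t with 2^t*2^t≡1+3c t
... | c , eq = divides c (≡.cong (ℕ._∸ 1) eq)

n%3≡1⇒3∤1+n : ∀ n → n ℕ.% 3 ≡ 1 → ¬ 3 ∣ 1 ℕ.+ n
n%3≡1⇒3∤1+n n n%3≡1 3∣1+n = ℕ.0≢1+n (begin
  0                        ≡⟨ n∣m⇒m%n≡0 (1 ℕ.+ n) 3 3∣1+n ⟨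
  (1 ℕ.+ n) ℕ.% 3          ≡⟨ %-distribˡ-+ 1 n 3 ⟩
  (1 ℕ.+ n ℕ.% 3) ℕ.% 3    ≡⟨ ≡.cong (λ r → (1 ℕ.+ r) ℕ.% 3) n%3≡1 ⟩
  2                        ∎)
  where open ≡.≡-Reasoning

module CommutativeRingProperties {c ℓ : Level} (R : CommutativeRing c ℓ) where
  open CommutativeRing R
  open import Algebra.Properties.CommutativeSemiring.Exp commutativeSemiring public
  open import Algebra.Properties.Ring ring using (+-inverseʳ-unique; -‿involutive)
  open import Algebra.Properties.Semiring.Mult semiring using (_×_; ×1-homo-*)
  open import Algebra.Solver.Ring.NaturalCoefficients.Default commutativeSemiring
  open import Relation.Binary.Reasoning.Setoid setoid

  pow≡^ : ∀ x n → pow R x n ≡ x ^ n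
  pow≡^ x zero    = ≡.refl
  pow≡^ x (suc n) = ≡.cong (x *_) (pow≡^ x n)

  Mpoly≡ : ∀ β n x → Mpoly R β n x ≡ (x + β + 1#) ^ n + (x + β) ^ n
  Mpoly≡ β n x = ≡.cong₂ _+_ (pow≡^ (x + β + 1#) n) (pow≡^ (x + β) n)

  Npoly≡ : ∀ β n x → Npoly R β n x ≡ β * (x + β + 1#) ^ n + (β + 1#) * (x + β) ^ n
  Npoly≡ β n x = ≡.cong₂ (λ u v → β * u + (β + 1#) * v) (pow≡^ (x + β + 1#) n) (pow≡^ (x + β) n)

  x-y+y≈x : ∀ x y → x - y + y ≈ x
  x-y+y≈x x y = trans (+-assoc x (- y) y) (trans (+-congˡ (-‿inverseˡ y)) (+-identityʳ x))

  x+y-y≈x : ∀ x y → x + y - y ≈ x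
  x+y-y≈x x y = trans (+-assoc x y (- y)) (trans (+-congˡ (-‿inverseʳ y)) (+-identityʳ x))

  1^n≈1 : ∀ n → 1# ^ n ≈ 1#
  1^n≈1 zero    = refl
  1^n≈1 (suc n) = trans (*-identityˡ _) (1^n≈1 n)

  ^-comm : ∀ x m n → (x ^ m) ^ n ≈ (x ^ n) ^ m
  ^-comm x m n = begin
    (x ^ m) ^ n     ≈⟨ ^-assocʳ x m n ⟩
    x ^ (m ℕ.* n)   ≡⟨ ≡.cong (x ^_) (ℕ.*-comm m n) ⟩
    x ^ (n ℕ.* m)   ≈⟨ ^-assocʳ x n m ⟨
    (x ^ n) ^ m     ∎

  ^×1≈×1^ : ∀ p t → (p ℕ.^ t) × 1# ≈ (p × 1#) ^ t
  ^×1≈×1^ p zero    = +-identityʳ 1#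
  ^×1≈×1^ p (suc t) = trans (×1-homo-* p (p ℕ.^ t)) (*-congˡ (^×1≈×1^ p t))

  twist-^ : ∀ q {x y μ} → y ^ q * x ≈ μ * y → ∀ n → (y ^ n) ^ q * x ^ n ≈ μ ^ n * y ^ n
  twist-^ q {x} {y} {μ} y^q*x≈μy n = begin
    (y ^ n) ^ q * x ^ n    ≈⟨ *-congʳ (^-comm y n q) ⟩
    (y ^ q) ^ n * x ^ n    ≈⟨ ^-distrib-* (y ^ q) x n ⟨
    (y ^ q * x) ^ n        ≈⟨ ^-congˡ n y^q*x≈μy ⟩
    (μ * y) ^ n            ≈⟨ ^-distrib-* μ y n ⟩
    μ ^ n * y ^ n          ∎

  module CharacteristicTwo (1+1≈0 : 1# + 1# ≈ 0#) where

    x+x≈0 : ∀ x → x + x ≈ 0#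
    x+x≈0 x = begin
      x + x            ≈⟨ solve 1 (λ x → x :+ x := (con 1 :+ con 1) :* x) refl x ⟩
      (1# + 1#) * x    ≈⟨ *-congʳ 1+1≈0 ⟩
      0# * x           ≈⟨ zeroˡ x ⟩
      0#               ∎

    x+y≈0⇒x≈y : ∀ {x y} → x + y ≈ 0# → x ≈ y
    x+y≈0⇒x≈y {x} {y} x+y≈0 = begin
      x        ≈⟨ -‿involutive x ⟨
      - (- x)  ≈⟨ -‿cong (+-inverseʳ-unique x y x+y≈0) ⟨
      - y      ≈⟨ +-inverseʳ-unique y y (x+x≈0 y) ⟨
      y        ∎

    ^2-distrib-+ : ∀ x y → (x + y) ^ 2 ≈ x ^ 2 + y ^ 2
    ^2-distrib-+ x y = begin
      (x + y) ^ 2                        ≈⟨ solve 2 (λ x y → (x :+ y) :^ 2 := x :^ 2 :+ y :^ 2 :+ (x :* y :+ x :* y)) refl x y ⟩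
      x ^ 2 + y ^ 2 + (x * y + x * y)    ≈⟨ +-congˡ (x+x≈0 (x * y)) ⟩
      x ^ 2 + y ^ 2 + 0#                 ≈⟨ +-identityʳ _ ⟩
      x ^ 2 + y ^ 2                      ∎

    frobenius : ∀ t x y → (x + y) ^ (2 ℕ.^ t) ≈ x ^ (2 ℕ.^ t) + y ^ (2 ℕ.^ t)
    frobenius zero    x y = trans (*-identityʳ _) (sym (+-cong (*-identityʳ x) (*-identityʳ y)))
    frobenius (suc t) x y = begin
      (x + y) ^ (2 ℕ.* 2 ℕ.^ t)                ≈⟨ ^-assocʳ (x + y) 2 (2 ℕ.^ t) ⟨
      ((x + y) ^ 2) ^ 2 ℕ.^ t                  ≈⟨ ^-congˡ (2 ℕ.^ t) (^2-distrib-+ x y) ⟩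
      (x ^ 2 + y ^ 2) ^ 2 ℕ.^ t                ≈⟨ frobenius t (x ^ 2) (y ^ 2) ⟩
      (x ^ 2) ^ 2 ℕ.^ t + (y ^ 2) ^ 2 ℕ.^ t    ≈⟨ +-cong (^-assocʳ x 2 (2 ℕ.^ t)) (^-assocʳ y 2 (2 ℕ.^ t)) ⟩
      x ^ (2 ℕ.* 2 ℕ.^ t) + y ^ (2 ℕ.* 2 ℕ.^ t)  ∎

    module CubeRootOfUnity {β : Carrier} (β²+β+1≈0 : β * β + β + 1# ≈ 0#) where

      β²≈β+1 : β * β ≈ β + 1#
      β²≈β+1 = x+y≈0⇒x≈y (trans (sym (+-assoc (β * β) β 1#)) β²+β+1≈0)

      β²+β≈1 : β * β + β ≈ 1#
      β²+β≈1 = x+y≈0⇒x≈y β²+β+1≈0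

      β²+1≈β : β * β + 1# ≈ β
      β²+1≈β = x+y≈0⇒x≈y (trans (solve 1 (λ b → b :* b :+ con 1 :+ b := b :* b :+ b :+ con 1) refl β) β²+β+1≈0)

      β³≈1 : β * β * β ≈ 1#
      β³≈1 = x+y≈0⇒x≈y (begin
        β * β * β + 1#             ≈⟨ +-congˡ β²+β≈1 ⟨
        β * β * β + (β * β + β)    ≈⟨ solve 1 (λ b → b :* b :* b :+ (b :* b :+ b) := b :* (b :* b :+ b :+ con 1)) refl β ⟩
        β * (β * β + β + 1#)       ≈⟨ *-congˡ β²+β+1≈0 ⟩
        β * 0#                     ≈⟨ zeroʳ β ⟩
        0#                         ∎)

      β^[3+n]≈β^n : ∀ n → β ^ (3 ℕ.+ n) ≈ β ^ n
      β^[3+n]≈β^n n = begin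
        β ^ (3 ℕ.+ n)      ≈⟨ ^-homo-* β 3 n ⟩
        β ^ 3 * β ^ n      ≈⟨ *-congʳ (trans (solve 1 (λ b → b :^ 3 := b :* b :* b) refl β) β³≈1) ⟩
        1# * β ^ n         ≈⟨ *-identityˡ _ ⟩
        β ^ n              ∎

      β^[3c+n]≈β^n : ∀ c n → β ^ (3 ℕ.* c ℕ.+ n) ≈ β ^ n
      β^[3c+n]≈β^n zero    n = refl
      β^[3c+n]≈β^n (suc c) n = begin
        β ^ (3 ℕ.* suc c ℕ.+ n)      ≡⟨ ≡.cong (λ m → β ^ (m ℕ.+ n)) (ℕ.*-suc 3 c) ⟩
        β ^ (3 ℕ.+ (3 ℕ.* c ℕ.+ n))  ≈⟨ β^[3+n]≈β^n (3 ℕ.* c ℕ.+ n) ⟩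
        β ^ (3 ℕ.* c ℕ.+ n)          ≈⟨ β^[3c+n]≈β^n c n ⟩
        β ^ n                        ∎

      β^[2^[2k+1]]≈β² : ∀ k → β ^ (2 ℕ.^ (2 ℕ.* k ℕ.+ 1)) ≈ β * β
      β^[2^[2k+1]]≈β² k with 2^[2k+1]≡3c+2 k
      ... | c , 2^[2k+1]≡3c+2 = begin
        β ^ (2 ℕ.^ (2 ℕ.* k ℕ.+ 1))  ≡⟨ ≡.cong (β ^_) 2^[2k+1]≡3c+2 ⟩
        β ^ (3 ℕ.* c ℕ.+ 2)          ≈⟨ β^[3c+n]≈β^n c 2 ⟩
        β * (β * 1#)                 ≈⟨ *-congˡ (*-identityʳ β) ⟩
        β * β                        ∎

      module _ (1≉0 : ¬ 1# ≈ 0#) where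

        β≉0 : ¬ β ≈ 0#
        β≉0 β≈0 = 1≉0 (begin
          1#             ≈⟨ β²+β≈1 ⟨
          β * β + β      ≈⟨ +-cong (*-cong β≈0 β≈0) β≈0 ⟩
          0# * 0# + 0#   ≈⟨ trans (+-identityʳ _) (zeroˡ 0#) ⟩
          0#             ∎)

        β≉1 : ¬ β ≈ 1#
        β≉1 β≈1 = 1≉0 (begin
          1#             ≈⟨ β²+β≈1 ⟨
          β * β + β      ≈⟨ +-cong (*-cong β≈1 β≈1) β≈1 ⟩
          1# * 1# + 1#   ≈⟨ +-congʳ (*-identityˡ 1#) ⟩
          1# + 1#        ≈⟨ 1+1≈0 ⟩
          0#             ∎)

        β²≉1 : ¬ β * β ≈ 1#
        β²≉1 β²≈1 = β≉0 (begin
          β              ≈⟨ β²+1≈β ⟨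
          β * β + 1#     ≈⟨ +-congʳ β²≈1 ⟩
          1# + 1#        ≈⟨ 1+1≈0 ⟩
          0#             ∎)

        β^n≈1⇒3∣n : ∀ n → β ^ n ≈ 1# → 3 ∣ n
        β^n≈1⇒3∣n 0             _    = 3 ∣0
        β^n≈1⇒3∣n 1             β≈1  = ⊥-elim (β≉1 (trans (sym (*-identityʳ β)) β≈1))
        β^n≈1⇒3∣n 2             β²≈1 = ⊥-elim (β²≉1 (trans (*-congˡ (sym (*-identityʳ β))) β²≈1))
        β^n≈1⇒3∣n (suc (suc (suc n))) β^[3+n]≈1 =
          ∣m∣n⇒∣m+n ∣-refl (β^n≈1⇒3∣n n (trans (sym (β^[3+n]≈β^n n)) β^[3+n]≈1))

module FiniteFieldProperties {c ℓ : Level} {m : ℕ} (F : FiniteField c ℓ m) where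
  open FiniteField F renaming (ring to R)
  open CommutativeRing R
  open CommutativeRingProperties R
  open import Algebra.Properties.Ring ring using (+-identityʳ-unique)
  open import Algebra.Properties.Semiring.Mult semiring using (_×_)
  open import Algebra.Properties.CommutativeMonoid.Sum +-commutativeMonoid
    using (sum; ∑-permute; ∑-distrib-+; sum-replicate; sum-cong-≋)
  open import Relation.Binary.Reasoning.Setoid setoid

  index : Carrier → Fin m
  index x = proj₁ (enum-surj x)

  enum-index : ∀ x → enum (index x) ≈ x
  enum-index x = proj₂ (enum-surj x)

  _≟_ : Decidable _≈_
  x ≟ y = map′ index≡⇒≈ ≈⇒index≡ (index x Fin.≟ index y)
    where
    index≡⇒≈ : index x ≡ index y → x ≈ y
    index≡⇒≈ eq = trans (sym (enum-index x)) (trans (reflexive (≡.cong enum eq)) (enum-index y))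
    ≈⇒index≡ : x ≈ y → index x ≡ index y
    ≈⇒index≡ x≈y = enum-inj _ _ (trans (enum-index x) (trans x≈y (sym (enum-index y))))

  *-cancelʳ : ∀ {x y z} → ¬ z ≈ 0# → x * z ≈ y * z → x ≈ y
  *-cancelʳ {x} {y} {z} z≉0 xz≈yz = begin
    x                ≈⟨ *-identityʳ x ⟨
    x * 1#           ≈⟨ *-congˡ zz⁻¹≈1 ⟨
    x * (z * z⁻¹)    ≈⟨ *-assoc x z z⁻¹ ⟨
    x * z * z⁻¹      ≈⟨ *-congʳ xz≈yz ⟩
    y * z * z⁻¹      ≈⟨ *-assoc y z z⁻¹ ⟩
    y * (z * z⁻¹)    ≈⟨ *-congˡ zz⁻¹≈1 ⟩
    y * 1#           ≈⟨ *-identityʳ y ⟩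
    y                ∎
    where
    z⁻¹ : Carrier
    z⁻¹ = proj₁ (inverse z z≉0)
    zz⁻¹≈1 : z * z⁻¹ ≈ 1#
    zz⁻¹≈1 = proj₂ (inverse z z≉0)

  *-cancelˡ : ∀ {x y z} → ¬ z ≈ 0# → z * x ≈ z * y → x ≈ y
  *-cancelˡ {x} {y} {z} z≉0 zx≈zy = *-cancelʳ z≉0 (trans (*-comm x z) (trans zx≈zy (*-comm z y)))

  x*y≉0 : ∀ {x y} → ¬ x ≈ 0# → ¬ y ≈ 0# → ¬ x * y ≈ 0#
  x*y≉0 {x} {y} x≉0 y≉0 xy≈0 = x≉0 (*-cancelʳ y≉0 (trans xy≈0 (sym (zeroˡ y))))

  x^n≉0 : ∀ {x} → ¬ x ≈ 0# → ∀ n → ¬ x ^ n ≈ 0#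
  x^n≉0 x≉0 zero    = 1≉0
  x^n≉0 x≉0 (suc n) = x*y≉0 x≉0 (x^n≉0 x≉0 n)

  x^n≈0⇒x≈0 : ∀ {x} n → x ^ n ≈ 0# → x ≈ 0#
  x^n≈0⇒x≈0 {x} n x^n≈0 with x ≟ 0#
  ... | yes x≈0 = x≈0
  ... | no  x≉0 = ⊥-elim (x^n≉0 x≉0 n x^n≈0)

  card×1≈0 : m × 1# ≈ 0#
  card×1≈0 = +-identityʳ-unique (sum enum) (m × 1#) (begin
    sum enum + m × 1#                    ≈⟨ +-congˡ (sum-replicate m) ⟨
    sum enum + sum (replicate m 1#)      ≈⟨ ∑-distrib-+ enum (replicate m 1#) ⟨
    sum (λ i → enum i + 1#)              ≈⟨ sum-cong-≋ (λ i → enum-index (enum i + 1#)) ⟨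
    sum (λ i → enum (successor i))       ≈⟨ ∑-permute enum shift ⟨
    sum enum                             ∎)
    where
    successor predecessor : Fin m → Fin m
    successor i   = index (enum i + 1#)
    predecessor i = index (enum i - 1#)
    shift : Permutation′ m
    shift = permutation successor predecessor
      (λ i → enum-inj _ i (trans (enum-index _) (trans (+-congʳ (enum-index _)) (x-y+y≈x (enum i) 1#))))
      (λ i → enum-inj _ i (trans (enum-index _) (trans (+-congʳ (enum-index _)) (x+y-y≈x (enum i) 1#))))

  characteristic-two : ∀ s → m ≡ 2 ℕ.^ s → 1# + 1# ≈ 0#
  characteristic-two s m≡2^s = trans (+-congˡ (sym (+-identityʳ 1#))) (x^n≈0⇒x≈0 s (begin
    (2 × 1#) ^ s    ≈⟨ ^×1≈×1^ 2 s ⟨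
    (2 ℕ.^ s) × 1#  ≡⟨ ≡.cong (_× 1#) m≡2^s ⟨
    m × 1#          ≈⟨ card×1≈0 ⟩
    0#              ∎))

  module UnitCircle (1+1≈0 : 1# + 1# ≈ 0#) {β : Carrier} (β²+β+1≈0 : β * β + β + 1# ≈ 0#)
                    (q : ℕ) (frobenius-q : ∀ y z → (y + z) ^ q ≈ y ^ q + z ^ q)
                    (β^q≈β² : β ^ q ≈ β * β) {x : Carrier} (x^[q+1]≈1 : pow R x (q ℕ.+ 1) ≈ 1#) where
    open CharacteristicTwo 1+1≈0
    open CubeRootOfUnity β²+β+1≈0
    open import Algebra.Solver.Ring.NaturalCoefficients.Default commutativeSemiring

    x^q*x≈1 : x ^ q * x ≈ 1#
    x^q*x≈1 = begin
      x ^ q * x            ≈⟨ *-congˡ (*-identityʳ x) ⟨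
      x ^ q * x ^ 1        ≈⟨ ^-homo-* x q 1 ⟨
      x ^ (q ℕ.+ 1)        ≡⟨ pow≡^ x (q ℕ.+ 1) ⟨
      pow R x (q ℕ.+ 1)    ≈⟨ x^[q+1]≈1 ⟩
      1#                   ∎

    [x+β]^q≈x^q+β² : (x + β) ^ q ≈ x ^ q + β * β
    [x+β]^q≈x^q+β² = trans (frobenius-q x β) (+-congˡ β^q≈β²)

    [x+β+1]^q*x≈β[x+β+1] : (x + β + 1#) ^ q * x ≈ β * (x + β + 1#)
    [x+β+1]^q*x≈β[x+β+1] = begin
      (x + β + 1#) ^ q * x              ≈⟨ *-congʳ (trans (frobenius-q (x + β) 1#) (+-cong [x+β]^q≈x^q+β² (1^n≈1 q))) ⟩
      (x ^ q + β * β + 1#) * x          ≈⟨ solve 3 (λ X x b → (X :+ b :* b :+ con 1) :* x := X :* x :+ (b :* b :+ con 1) :* x) refl (x ^ q) x β ⟩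
      x ^ q * x + (β * β + 1#) * x      ≈⟨ +-cong x^q*x≈1 (*-congʳ β²+1≈β) ⟩
      1# + β * x                        ≈⟨ +-congʳ β²+β≈1 ⟨
      β * β + β + β * x                 ≈⟨ solve 2 (λ x b → b :* b :+ b :+ b :* x := b :* (x :+ b :+ con 1)) refl x β ⟩
      β * (x + β + 1#)                  ∎

    [x+β]^q*x≈β²[x+β] : (x + β) ^ q * x ≈ β * β * (x + β)
    [x+β]^q*x≈β²[x+β] = begin
      (x + β) ^ q * x                   ≈⟨ *-congʳ [x+β]^q≈x^q+β² ⟩
      (x ^ q + β * β) * x               ≈⟨ distribʳ x (x ^ q) (β * β) ⟩
      x ^ q * x + β * β * x             ≈⟨ +-congʳ x^q*x≈1 ⟩
      1# + β * β * x                    ≈⟨ +-congʳ β³≈1 ⟨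
      β * β * β + β * β * x             ≈⟨ solve 2 (λ x b → b :* b :* b :+ b :* b :* x := b :* b :* (x :+ b)) refl x β ⟩
      β * β * (x + β)                   ∎

    [x+β]^n≉0 : ∀ n k → (x + β + 1#) ^ n ≈ β ^ k * (x + β) ^ n → ¬ (x + β) ^ n ≈ 0#
    [x+β]^n≉0 n k A≈β^kB B≈0 = 1≉0 (begin
      1#            ≈⟨ +-identityˡ 1# ⟨
      0# + 1#       ≈⟨ +-congʳ (x^n≈0⇒x≈0 n B≈0) ⟨
      x + β + 1#    ≈⟨ x^n≈0⇒x≈0 n (trans A≈β^kB (trans (*-congˡ B≈0) (zeroʳ _))) ⟩
      0#            ∎)

    β^[k+n]≈1 : ∀ k n → (x + β + 1#) ^ n ≈ β ^ k * (x + β) ^ n → β ^ (k ℕ.+ n) ≈ 1#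
    β^[k+n]≈1 k n A≈β^kB = sym (*-cancelʳ (x^n≉0 (β≉0 1≉0) (k ℕ.+ n))
      (trans (*-identityˡ _) (*-cancelʳ ([x+β]^n≉0 n k A≈β^kB) yB≈yyB)))
      where
      A B : Carrier
      A = (x + β + 1#) ^ n
      B = (x + β) ^ n
      yB≈yyB : β ^ (k ℕ.+ n) * B ≈ β ^ (k ℕ.+ n) * β ^ (k ℕ.+ n) * B
      yB≈yyB = begin
        β ^ (k ℕ.+ n) * B                  ≈⟨ *-congʳ (^-homo-* β k n) ⟩
        β ^ k * β ^ n * B                  ≈⟨ solve 3 (λ u v w → u :* v :* w := v :* (u :* w)) refl (β ^ k) (β ^ n) B ⟩
        β ^ n * (β ^ k * B)                ≈⟨ *-congˡ A≈β^kB ⟨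
        β ^ n * A                          ≈⟨ twist-^ q [x+β+1]^q*x≈β[x+β+1] n ⟨
        A ^ q * x ^ n                      ≈⟨ *-congʳ (^-congˡ q A≈β^kB) ⟩
        (β ^ k * B) ^ q * x ^ n            ≈⟨ *-congʳ (^-distrib-* (β ^ k) B q) ⟩
        (β ^ k) ^ q * B ^ q * x ^ n        ≈⟨ *-assoc ((β ^ k) ^ q) (B ^ q) (x ^ n) ⟩
        (β ^ k) ^ q * (B ^ q * x ^ n)      ≈⟨ *-cong (trans (^-comm β k q) (^-congˡ k β^q≈β²)) (twist-^ q [x+β]^q*x≈β²[x+β] n) ⟩
        (β * β) ^ k * ((β * β) ^ n * B)    ≈⟨ *-assoc ((β * β) ^ k) ((β * β) ^ n) B ⟨
        (β * β) ^ k * (β * β) ^ n * B      ≈⟨ *-congʳ (^-homo-* (β * β) k n) ⟨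
        (β * β) ^ (k ℕ.+ n) * B            ≈⟨ *-congʳ (^-distrib-* β β (k ℕ.+ n)) ⟩
        β ^ (k ℕ.+ n) * β ^ (k ℕ.+ n) * B  ∎

    Mpoly≈0⇒β^n≈1 : ∀ n → Mpoly R β n x ≈ 0# → β ^ n ≈ 1#
    Mpoly≈0⇒β^n≈1 n M≈0 = β^[k+n]≈1 0 n (begin
      (x + β + 1#) ^ n     ≈⟨ x+y≈0⇒x≈y (trans (reflexive (≡.sym (Mpoly≡ β n x))) M≈0) ⟩
      (x + β) ^ n          ≈⟨ *-identityˡ _ ⟨
      1# * (x + β) ^ n     ∎)

    Npoly≈0⇒β^[1+n]≈1 : ∀ n → Npoly R β n x ≈ 0# → β ^ (1 ℕ.+ n) ≈ 1#
    Npoly≈0⇒β^[1+n]≈1 n N≈0 = β^[k+n]≈1 1 n (*-cancelˡ (β≉0 1≉0) (begin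
      β * (x + β + 1#) ^ n          ≈⟨ x+y≈0⇒x≈y (trans (reflexive (≡.sym (Npoly≡ β n x))) N≈0) ⟩
      (β + 1#) * (x + β) ^ n        ≈⟨ *-congʳ β²≈β+1 ⟨
      β * β * (x + β) ^ n           ≈⟨ *-assoc β β _ ⟩
      β * (β * (x + β) ^ n)         ≈⟨ *-congˡ (*-congʳ (*-identityʳ β)) ⟨
      β * (β ^ 1 * (x + β) ^ n)     ∎))

open import Data.Nat using (_^_)
open import Data.Product using (_×_)

mainTheorem2 : ∀ {c ℓ} (t : ℕ) → ∃ (λ k → t ≡ 2 ℕ.* k ℕ.+ 1) →
    let q = 2 ^ t in
    (F : FiniteField c ℓ (q ℕ.* q)) →
    let R = FiniteField.ring F in
    let open CommutativeRing R in
    (β : Carrier) → β * β + β + 1# ≈ 0# → ¬ (pow R β q ≈ β) →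
    (n : ℕ) → 1 ≤ n → gcd n (q ℕ.* q ∸ 1) ≡ 1 →
    (∀ x → pow R x (q ℕ.+ 1) ≈ 1# → ¬ (Mpoly R β n x ≈ 0#))
    × (n % 3 ≡ 1 → ∀ x → pow R x (q ℕ.+ 1) ≈ 1# → ¬ (Npoly R β n x ≈ 0#))
mainTheorem2 t (k , ≡.refl) F β β²+β+1≈0 _ n _ gcd≡1 =
    (λ x x^[q+1]≈1 M≈0 → 3∤n (β^n≈1⇒3∣n 1≉0 n (Circle.Mpoly≈0⇒β^n≈1 x^[q+1]≈1 n M≈0)))
  , (λ n%3≡1 x x^[q+1]≈1 N≈0 → n%3≡1⇒3∤1+n n n%3≡1
       (β^n≈1⇒3∣n 1≉0 (1 ℕ.+ n) (Circle.Npoly≈0⇒β^[1+n]≈1 x^[q+1]≈1 n N≈0)))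
  where
  open FiniteField F using (1≉0) renaming (ring to R)
  open CommutativeRing R using (_+_; _≈_; 1#; 0#)
  open CommutativeRingProperties R using (module CharacteristicTwo)
  open FiniteFieldProperties F using (characteristic-two; module UnitCircle)

  1+1≈0 : 1# + 1# ≈ 0#
  1+1≈0 = characteristic-two (t ℕ.+ t) (≡.sym (ℕ.^-distribˡ-+-* 2 t t))

  open CharacteristicTwo 1+1≈0 using (frobenius; module CubeRootOfUnity)
  open CubeRootOfUnity β²+β+1≈0 using (β^[2^[2k+1]]≈β²; β^n≈1⇒3∣n)
  module Circle = UnitCircle 1+1≈0 β²+β+1≈0 (2 ^ t) (frobenius t) (β^[2^[2k+1]]≈β² k)

  3∤n : ¬ 3 ∣ n
  3∤n 3∣n with ∣1⇒≡1 (≡.subst (3 ∣_) gcd≡1 (gcd-greatest 3∣n (3∣2^t*2^t∸1 t)))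
  ... | ()
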